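{- Let $r\ge1$ and $n$ be integers with $3r+2\le n\le 4r+1$, let $C_n$ be the cycle with vertices $x_1,\dots,x_n$ labeled consecutively (indices taken modulo $n$), and let $D\subseteq V(C_n)$. Then $D$ is an $r$-identifying code of $C_n$ if and only if for every $i\in\{1,\dots,n\}$, $x_i\in D$ or $x_{i+2r+1}\in D$.
   Context: For a graph $G=(V,E)$ and integer $r\ge1$, $d(x,y)$ is the number of edges in a shortest path between $x$ and $y$, $N_r[x]=\{y\in V: d(x,y)\le r\}$, and for $D\subseteq V$, $D_r(x)=N_r[x]\cap D$. A set $D\subseteq V$ is an $r$-identifying code of $G$ if $D_r(x)\neq\emptyset$ for every $x\in V$ and $D_r(x)\neq D_r(y)$ for all distinct $x,y\in V$. -}

module Defs where

open import Data.Nat using (ℕ; zero; suc; _+_; _%_; _≤_; NonZero)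
open import Data.Fin using (Fin; toℕ)
open import Data.Product using (_×_; ∃-syntax)
open import Data.Sum using (_⊎_)
open import Relation.Binary.PropositionalEquality using (_≡_)
open import Relation.Nullary using (¬_)
open import Function.Bundles using (_⇔_)
open import Data.Nat.DivMod using (_mod_)
open import Data.Fin.Subset using (Subset; _∈_)

Graph : ℕ → Set₁
Graph n = Fin n → Fin n → Set

data Walk {n : ℕ} (G : Graph n) : ℕ → Fin n → Fin n → Set where
  here : ∀ {x} → Walk G zero x x
  step : ∀ {k x y z} → G x y → Walk G k y z → Walk G (suc k) x z

-- d(x,y) ≤ r  iff there is a walk (equivalently a path) with at most r edges.
DistLe : ∀ {n} → Graph n → ℕ → Fin n → Fin n → Set
DistLe G r x y = ∃[ k ] (k ≤ r × Walk G k x y)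

InDr : ∀ {n} → Graph n → ℕ → Subset n → Fin n → Fin n → Set
InDr G r D x z = z ∈ D × DistLe G r x z

IsIdentifyingCode : ∀ {n} → Graph n → ℕ → Subset n → Set
IsIdentifyingCode {n} G r D =
  (∀ (x : Fin n) → ∃[ z ] InDr G r D x z) ×
  (∀ (x y : Fin n) → ¬ x ≡ y → ¬ (∀ (z : Fin n) → InDr G r D x z ⇔ InDr G r D y z))

-- The cycle C_n on Fin n: vertex i (standing for x_{i+1}) is adjacent to i+1 and i-1 mod n.
Cycle : (n : ℕ) → .{{NonZero n}} → Graph n
Cycle n i j = (toℕ j ≡ (suc (toℕ i)) % n) ⊎ (toℕ i ≡ (suc (toℕ j)) % n)

shift : (n : ℕ) → .{{_ : NonZero n}} → Fin n → ℕ → Fin n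
shift n i k = (toℕ i + k) mod n

module Submission where

-- All remaining facts are
-- linear inequalities between offsets, each certified by an explicit slack and the ring solver.
-- (⇒) If x_i, x_{i+2r+1} ∉ D, then x_{i+r} and x_{i+r+1} have the same r-balls except at
--     these two vertices, so they get the same codeword sets.
-- (⇐) Domination: one of x_{j+r}, x_{j+3r+1} is a codeword within distance r of x_j.
--     Separation: for y = x ⊕ t we exhibit a pair {i, i ⊕ (2r+1)} with i only in the ball of x
--     and i ⊕ (2r+1) only in the ball of y (SeparatingOffsets), in a short and a long case.

open import Defs
open import Data.Nat using (ℕ; suc; _+_; _*_; _≤_; NonZero)
open import Data.Fin using (Fin)
open import Data.Fin.Subset using (Subset; _∈_)
open import Data.Sum using (_⊎_)
open import Function.Bundles using (_⇔_)

open import Data.Nat using (zero; _∸_; _<_; _%_; z≤n; s≤s; >-nonZero⁻¹)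
open import Data.Nat.Properties
open import Algebra.Properties.CommutativeSemigroup +-commutativeSemigroup using (x∙yz≈y∙xz)
open import Data.Nat.DivMod using (m<n⇒m%n≡m; [m+n]%n≡m%n; %-distribˡ-+; m%n%n≡m%n)
open import Data.Nat.Tactic.RingSolver using (solve)
open import Data.List using ([]; _∷_)
open import Data.Fin using (toℕ)
open import Data.Fin.Properties using (toℕ-injective; toℕ<n; toℕ-fromℕ<)
open import Data.Fin.Subset.Properties using (_∈?_)
open import Data.Product using (_×_; _,_; ∃-syntax; proj₂)
open import Data.Sum using (inj₁; inj₂)
open import Function.Bundles using (mk⇔; Equivalence)
open import Function.Properties.Equivalence using () renaming (sym to ⇔-sym)
open import Function.Construct.Composition using (_⇔-∘_)
open import Relation.Binary.PropositionalEquality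
open import Data.Empty using (⊥-elim)
open import Relation.Nullary using (¬_; Dec; yes; no)

≤-slack : ∀ {p q} (d : ℕ) → p + d ≡ q → p ≤ q
≤-slack {p} d refl = m≤m+n p d

-- p ≤ q as a consequence of a ≤ b, certified by the slack d with p + b + d = q + a.
-- With the ring solver proving the identity, each linear inequality below is one line.
≤-from : ∀ {a b p q} → a ≤ b → (d : ℕ) → p + b + d ≡ q + a → p ≤ q
≤-from {a} {b} {p} {q} a≤b d eq = +-cancelʳ-≤ a p q (begin
  p + a      ≤⟨ +-monoʳ-≤ p a≤b ⟩
  p + b      ≤⟨ m≤m+n (p + b) d ⟩
  p + b + d  ≡⟨ eq ⟩
  q + a      ∎)
  where open ≤-Reasoning

absurd-≤ : ∀ {A : Set} {p q} → p ≤ q → q < p → A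
absurd-≤ p≤q q<p = ⊥-elim (<⇒≱ q<p p≤q)

below-2n : ∀ {n m b} .{{_ : NonZero n}} → m < n + n → b < n → m % n ≡ b → m ≡ b ⊎ m ≡ b + n
below-2n {n} {m} {b} m<2n b<n m%n≡b with m <? n
... | yes m<n = inj₁ (trans (sym (m<n⇒m%n≡m m<n)) m%n≡b)
... | no m≮n = inj₂ (trans (sym (m∸n+n≡m n≤m)) (cong (_+ n) m∸n≡b))
  where
  open ≡-Reasoning
  n≤m : n ≤ m
  n≤m = ≮⇒≥ m≮n
  m∸n≡b : m ∸ n ≡ b
  m∸n≡b = begin
    m ∸ n            ≡⟨ m<n⇒m%n≡m (m<n+o⇒m∸n<o m n m<2n) ⟨
    (m ∸ n) % n      ≡⟨ [m+n]%n≡m%n (m ∸ n) n ⟨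
    (m ∸ n + n) % n  ≡⟨ cong (_% n) (m∸n+n≡m n≤m) ⟩
    m % n            ≡⟨ m%n≡b ⟩
    b                ∎

%-absorbˡ : ∀ m k n .{{_ : NonZero n}} → (m % n + k) % n ≡ (m + k) % n
%-absorbˡ m k n = begin
  (m % n + k) % n          ≡⟨ %-distribˡ-+ (m % n) k n ⟩
  (m % n % n + k % n) % n  ≡⟨ cong (λ v → (v + k % n) % n) (m%n%n≡m%n m n) ⟩
  (m % n + k % n) % n      ≡⟨ %-distribˡ-+ m k n ⟨
  (m + k) % n              ∎
  where open ≡-Reasoning

module Rotation (n : ℕ) .{{_ : NonZero n}} where

  infixl 6 _⊕_
  _⊕_ : Fin n → ℕ → Fin n
  x ⊕ k = shift n x k

  toℕ-⊕ : ∀ x k → toℕ (x ⊕ k) ≡ (toℕ x + k) % n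
  toℕ-⊕ x k = toℕ-fromℕ< _

  ⊕-≡ : ∀ x a y b → (toℕ x + a) % n ≡ (toℕ y + b) % n → x ⊕ a ≡ y ⊕ b
  ⊕-≡ x a y b eq = toℕ-injective (trans (toℕ-⊕ x a) (trans eq (sym (toℕ-⊕ y b))))

  ⊕-zero : ∀ x → x ⊕ 0 ≡ x
  ⊕-zero x = toℕ-injective (trans (toℕ-⊕ x 0)
    (trans (cong (_% n) (+-identityʳ (toℕ x))) (m<n⇒m%n≡m (toℕ<n x))))

  ⊕-assoc : ∀ x a b → x ⊕ a ⊕ b ≡ x ⊕ (a + b)
  ⊕-assoc x a b = toℕ-injective (begin
    toℕ (x ⊕ a ⊕ b)             ≡⟨ toℕ-⊕ (x ⊕ a) b ⟩
    (toℕ (x ⊕ a) + b) % n       ≡⟨ cong (λ v → (v + b) % n) (toℕ-⊕ x a) ⟩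
    ((toℕ x + a) % n + b) % n   ≡⟨ %-absorbˡ (toℕ x + a) b n ⟩
    (toℕ x + a + b) % n         ≡⟨ cong (_% n) (+-assoc (toℕ x) a b) ⟩
    (toℕ x + (a + b)) % n       ≡⟨ toℕ-⊕ x (a + b) ⟨
    toℕ (x ⊕ (a + b))           ∎)
    where open ≡-Reasoning

  ⊕-suc : ∀ x k → x ⊕ suc k ≡ x ⊕ k ⊕ 1
  ⊕-suc x k = sym (trans (⊕-assoc x k 1) (cong (x ⊕_) (+-comm k 1)))

  ⊕-comm : ∀ x y → x ⊕ toℕ y ≡ y ⊕ toℕ x
  ⊕-comm x y = ⊕-≡ x (toℕ y) y (toℕ x) (cong (_% n) (+-comm (toℕ x) (toℕ y)))

  ⊕-period : ∀ x k → x ⊕ (k + n) ≡ x ⊕ k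
  ⊕-period x k = ⊕-≡ x (k + n) x k
    (trans (cong (_% n) (sym (+-assoc (toℕ x) k n))) ([m+n]%n≡m%n (toℕ x + k) n))

  ⊕-n : ∀ x → x ⊕ n ≡ x
  ⊕-n x = trans (⊕-period x 0) (⊕-zero x)

  ⊕-full-turn : ∀ x {k} → k ≤ n → x ⊕ k ⊕ (n ∸ k) ≡ x
  ⊕-full-turn x {k} k≤n = trans (⊕-assoc x k (n ∸ k)) (trans (cong (x ⊕_) (m+[n∸m]≡n k≤n)) (⊕-n x))

  ⊕-cancelʳ : ∀ {x y k} → k ≤ n → x ⊕ k ≡ y ⊕ k → x ≡ y
  ⊕-cancelʳ {x} {y} {k} k≤n eq = begin
    x                   ≡⟨ ⊕-full-turn x k≤n ⟨
    x ⊕ k ⊕ (n ∸ k)     ≡⟨ cong (_⊕ (n ∸ k)) eq ⟩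
    y ⊕ k ⊕ (n ∸ k)     ≡⟨ ⊕-full-turn y k≤n ⟩
    y                   ∎
    where open ≡-Reasoning

  offset : ∀ x z → ∃[ u ] (u < n × z ≡ x ⊕ u)
  offset x z = toℕ w , toℕ<n w , sym (begin
    x ⊕ toℕ w                    ≡⟨ ⊕-comm x w ⟩
    z ⊕ (n ∸ toℕ x) ⊕ toℕ x      ≡⟨ ⊕-assoc z (n ∸ toℕ x) (toℕ x) ⟩
    z ⊕ (n ∸ toℕ x + toℕ x)      ≡⟨ cong (z ⊕_) (m∸n+n≡m (<⇒≤ (toℕ<n x))) ⟩
    z ⊕ n                        ≡⟨ ⊕-n z ⟩
    z                            ∎)
    where
    open ≡-Reasoning
    w : Fin n
    w = z ⊕ (n ∸ toℕ x)

  toℕ-⊕-unrotate : ∀ x a → toℕ (x ⊕ a ⊕ (n ∸ toℕ x)) ≡ a % n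
  toℕ-⊕-unrotate x a = begin
    toℕ (x ⊕ a ⊕ c)             ≡⟨ cong toℕ (⊕-assoc x a c) ⟩
    toℕ (x ⊕ (a + c))           ≡⟨ toℕ-⊕ x (a + c) ⟩
    (toℕ x + (a + c)) % n       ≡⟨ cong (_% n) (x∙yz≈y∙xz (toℕ x) a c) ⟩
    (a + (toℕ x + c)) % n       ≡⟨ cong (λ v → (a + v) % n) (m+[n∸m]≡n (<⇒≤ (toℕ<n x))) ⟩
    (a + n) % n                 ≡⟨ [m+n]%n≡m%n a n ⟩
    a % n                       ∎
    where
    open ≡-Reasoning
    c : ℕ
    c = n ∸ toℕ x

  ⊕-cancelˡ : ∀ x a b → x ⊕ a ≡ x ⊕ b → a % n ≡ b % n
  ⊕-cancelˡ x a b eq = trans (sym (toℕ-⊕-unrotate x a))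
    (trans (cong (λ v → toℕ (v ⊕ (n ∸ toℕ x))) eq) (toℕ-⊕-unrotate x b))

  ⊕-injective : ∀ x {a b} → a < n → b < n → x ⊕ a ≡ x ⊕ b → a ≡ b
  ⊕-injective x {a} {b} a<n b<n eq =
    trans (sym (m<n⇒m%n≡m a<n)) (trans (⊕-cancelˡ x a b eq) (m<n⇒m%n≡m b<n))

-- Cyclic positions a and b (read modulo n) are at distance at most r:
-- either |a - b| ≤ r, or one of the two ways round through position 0 has length ≤ r.
Close : ℕ → ℕ → ℕ → ℕ → Set
Close n r a b = (b ≤ a + r × a ≤ b + r) ⊎ (b + n ≤ a + r) ⊎ (a + n ≤ b + r)

Close-sym : ∀ {n r a b} → Close n r a b → Close n r b a
Close-sym (inj₁ (b≤ , a≤)) = inj₁ (a≤ , b≤)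
Close-sym (inj₂ (inj₁ wrap)) = inj₂ (inj₂ wrap)
Close-sym (inj₂ (inj₂ wrap)) = inj₂ (inj₁ wrap)

module CycleDistance (n : ℕ) .{{_ : NonZero n}} where
  open Rotation n

  Near : ℕ → Fin n → Fin n → Set
  Near r x z = ∃[ k ] (k ≤ r × (x ⊕ k ≡ z ⊎ z ⊕ k ≡ x))

  Near-sym : ∀ {r x z} → Near r x z → Near r z x
  Near-sym (k , k≤r , inj₁ eq) = k , k≤r , inj₂ eq
  Near-sym (k , k≤r , inj₂ eq) = k , k≤r , inj₁ eq

  toℕ-⊕1 : ∀ x → toℕ (x ⊕ 1) ≡ suc (toℕ x) % n
  toℕ-⊕1 x = trans (toℕ-⊕ x 1) (cong (_% n) (+-comm (toℕ x) 1))

  edge-forward : ∀ x → Cycle n x (x ⊕ 1)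
  edge-forward x = inj₁ (toℕ-⊕1 x)

  edge-backward : ∀ x → Cycle n (x ⊕ 1) x
  edge-backward x = inj₂ (toℕ-⊕1 x)

  edge-cases : ∀ {x y} → Cycle n x y → y ≡ x ⊕ 1 ⊎ x ≡ y ⊕ 1
  edge-cases {x} (inj₁ eq) = inj₁ (toℕ-injective (trans eq (sym (toℕ-⊕1 x))))
  edge-cases {y = y} (inj₂ eq) = inj₂ (toℕ-injective (trans eq (sym (toℕ-⊕1 y))))

  near-after-forward : ∀ {j x z} → Near j (x ⊕ 1) z → Near (suc j) x z
  near-after-forward {x = x} (k , k≤j , inj₁ eq) =
    suc k , s≤s k≤j , inj₁ (trans (sym (⊕-assoc x 1 k)) eq)
  near-after-forward (zero , _ , inj₂ eq) =
    1 , s≤s z≤n , inj₁ (trans (sym eq) (⊕-zero _))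
  near-after-forward {z = z} (suc k , k<j , inj₂ eq) =
    k , m≤n⇒m≤1+n (<⇒≤ k<j) , inj₂ (⊕-cancelʳ (>-nonZero⁻¹ n) (trans (sym (⊕-suc z k)) eq))

  near-after-backward : ∀ {j y z} → Near j y z → Near (suc j) (y ⊕ 1) z
  near-after-backward {y = y} (zero , _ , inj₁ eq) =
    1 , s≤s z≤n , inj₂ (cong (_⊕ 1) (trans (sym eq) (⊕-zero y)))
  near-after-backward {y = y} (suc k , k<j , inj₁ eq) =
    k , m≤n⇒m≤1+n (<⇒≤ k<j) , inj₁ (trans (⊕-assoc y 1 k) eq)
  near-after-backward {z = z} (k , k≤j , inj₂ eq) =
    suc k , s≤s k≤j , inj₂ (trans (⊕-suc z k) (cong (_⊕ 1) eq))

  walk→near : ∀ {k x z} → Walk (Cycle n) k x z → Near k x z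
  walk→near {x = x} here = 0 , z≤n , inj₁ (⊕-zero x)
  walk→near (step e w) with edge-cases e
  ... | inj₁ refl = near-after-forward (walk→near w)
  ... | inj₂ refl = near-after-backward (walk→near w)

  walk-forward : ∀ k x → Walk (Cycle n) k x (x ⊕ k)
  walk-forward zero x = subst (Walk (Cycle n) 0 x) (sym (⊕-zero x)) here
  walk-forward (suc k) x =
    step (edge-forward x) (subst (Walk (Cycle n) k (x ⊕ 1)) (⊕-assoc x 1 k) (walk-forward k (x ⊕ 1)))

  walk-backward : ∀ k z → Walk (Cycle n) k (z ⊕ k) z
  walk-backward zero z = subst (λ v → Walk (Cycle n) 0 v z) (sym (⊕-zero z)) here
  walk-backward (suc k) z = subst (λ v → Walk (Cycle n) (suc k) v z) (sym (⊕-suc z k))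
    (step (edge-backward (z ⊕ k)) (walk-backward k z))

  dist⇔near : ∀ {r x z} → DistLe (Cycle n) r x z ⇔ Near r x z
  dist⇔near {r} {x} {z} = mk⇔ to from
    where
    to : DistLe (Cycle n) r x z → Near r x z
    to (k , k≤r , w) with walk→near w
    ... | j , j≤k , eq = j , ≤-trans j≤k k≤r , eq
    from : Near r x z → DistLe (Cycle n) r x z
    from (k , k≤r , inj₁ refl) = k , k≤r , walk-forward k x
    from (k , k≤r , inj₂ refl) = k , k≤r , walk-backward k z

  turn→close : ∀ {r i a b k} → a < n → b < n → k ≤ r → r < n → i ⊕ a ⊕ k ≡ i ⊕ b → Close n r a b
  turn→close {r} {i} {a} {b} {k} a<n b<n k≤r r<n eq
    with below-2n (+-mono-< a<n (≤-<-trans k≤r r<n)) b<n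
           (trans (⊕-cancelˡ i (a + k) b (trans (sym (⊕-assoc i a k)) eq)) (m<n⇒m%n≡m b<n))
  ... | inj₁ refl = inj₁ (+-monoʳ-≤ a k≤r , ≤-trans (m≤m+n a k) (m≤m+n (a + k) r))
  ... | inj₂ a+k≡b+n = inj₂ (inj₁ (subst (_≤ a + r) a+k≡b+n (+-monoʳ-≤ a k≤r)))

  turn→near : ∀ {r i a c} → a ≤ c → c ≤ a + r → Near r (i ⊕ a) (i ⊕ c)
  turn→near {r} {i} {a} {c} a≤c c≤a+r =
    c ∸ a , m≤n+o⇒m∸n≤o c a c≤a+r , inj₁ (trans (⊕-assoc i a (c ∸ a)) (cong (i ⊕_) (m+[n∸m]≡n a≤c)))

  near⇔close : ∀ {r i a b} → a < n → b < n → r < n → Near r (i ⊕ a) (i ⊕ b) ⇔ Close n r a b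
  near⇔close {r} {i} {a} {b} a<n b<n r<n = mk⇔ to from
    where
    to : Near r (i ⊕ a) (i ⊕ b) → Close n r a b
    to (k , k≤r , inj₁ eq) = turn→close a<n b<n k≤r r<n eq
    to (k , k≤r , inj₂ eq) = Close-sym (turn→close b<n a<n k≤r r<n eq)
    wrapped : ∀ {a b} → a < n → b + n ≤ a + r → Near r (i ⊕ a) (i ⊕ b)
    wrapped {a} {b} a<n wrap = subst (Near r (i ⊕ a)) (⊕-period i b)
      (turn→near (≤-trans (<⇒≤ a<n) (m≤n+m n b)) wrap)
    from : Close n r a b → Near r (i ⊕ a) (i ⊕ b)
    from (inj₁ (b≤a+r , a≤b+r)) with a ≤? b
    ... | yes a≤b = turn→near a≤b b≤a+r
    ... | no a≰b = Near-sym (turn→near (<⇒≤ (≰⇒> a≰b)) a≤b+r)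
    from (inj₂ (inj₁ wrap)) = wrapped a<n wrap
    from (inj₂ (inj₂ wrap)) = Near-sym (wrapped b<n wrap)

  dist⇔close : ∀ {r i a b} → a < n → b < n → r < n → DistLe (Cycle n) r (i ⊕ a) (i ⊕ b) ⇔ Close n r a b
  dist⇔close a<n b<n r<n = near⇔close a<n b<n r<n ⇔-∘ dist⇔near

close-shift-back : ∀ {n r u} → 2 * r + 1 < n → u < n → u ≢ 2 * r + 1 → Close n r (r + 1) u → Close n r r u
close-shift-back {n} {r} {u} 2r+1<n u<n u≢2r+1 (inj₁ (u≤ , _)) =
  inj₁ (≤-from u<2r+1 0 (solve (r ∷ u ∷ [])) , m≤n+m r u)
  where
  u<2r+1 : u < 2 * r + 1
  u<2r+1 = ≤∧≢⇒< u≤2r+1 u≢2r+1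
    where
    u≤2r+1 : u ≤ 2 * r + 1
    u≤2r+1 = ≤-from u≤ 0 (solve (r ∷ u ∷ []))
close-shift-back {n} {r} {u} 2r+1<n u<n u≢2r+1 (inj₂ (inj₁ wrap)) =
  absurd-≤ wrap (≤-from 2r+1<n u (solve (r ∷ u ∷ n ∷ [])))
close-shift-back {n} {r} {u} 2r+1<n u<n u≢2r+1 (inj₂ (inj₂ wrap)) =
  absurd-≤ wrap (≤-from u<n 1 (solve (r ∷ u ∷ n ∷ [])))

close-shift-forward : ∀ {n r u} → 2 * r + 1 < n → u < n → u ≢ 0 → Close n r r u → Close n r (r + 1) u
close-shift-forward {n} {r} {u} 2r+1<n u<n u≢0 (inj₁ (u≤ , _)) =
  inj₁ (≤-from u≤ 1 (solve (r ∷ u ∷ [])) , ≤-from (n≢0⇒n>0 u≢0) 0 (solve (r ∷ u ∷ [])))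
close-shift-forward {n} {r} {u} 2r+1<n u<n u≢0 (inj₂ (inj₁ wrap)) =
  absurd-≤ wrap (≤-from 2r+1<n (suc u) (solve (r ∷ u ∷ n ∷ [])))
close-shift-forward {n} {r} {u} 2r+1<n u<n u≢0 (inj₂ (inj₂ wrap)) =
  absurd-≤ wrap (≤-from u<n 0 (solve (r ∷ u ∷ n ∷ [])))

close-3r+1 : ∀ {n r} → n ≤ 4 * r + 1 → Close n r 0 (r + (2 * r + 1))
close-3r+1 {n} {r} n≤4r+1 = inj₂ (inj₂ (≤-from n≤4r+1 0 (solve (r ∷ n ∷ []))))

record SeparatingOffsets (n r t : ℕ) : Set where
  field
    a b      : ℕ
    a<n      : a < n
    b<n      : b < n
    paired   : a + (2 * r + 1) ≡ b + n
    x-near-a : Close n r 0 a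
    y-far-a  : ¬ Close n r t a
    y-near-b : Close n r t b
    x-far-b  : ¬ Close n r 0 b

-- Short separation t + 2r + 1 ≤ n: take i = x - r (offset n - r), so i ⊕ (2r+1) = x ⊕ (r+1).
offsets-short : ∀ {n r t} → 1 ≤ r → 3 * r + 2 ≤ n → n ≤ 4 * r + 1 → 1 ≤ t → t + (2 * r + 1) ≤ n →
  SeparatingOffsets n r t
offsets-short {n} {r} {t} 1≤r 3r+2≤n n≤4r+1 1≤t short = build (m≤n⇒∃[o]m+o≡n r≤n)
  where
  r≤n : r ≤ n
  r≤n = ≤-from 3r+2≤n (2 * r + 2) (solve (r ∷ n ∷ []))
  build : ∃[ o ] r + o ≡ n → SeparatingOffsets n r t
  build (o , r+o≡n) = record
    { a = o
    ; b = r + 1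
    ; a<n = ≤-from (+-mono-≤ 1≤r (≤-reflexive r+o≡n)) 0 (solve (o ∷ r ∷ n ∷ []))
    ; b<n = ≤-from 3r+2≤n (2 * r) (solve (r ∷ n ∷ []))
    ; paired = trans regroup (cong ((r + 1) +_) r+o≡n)
    ; x-near-a = inj₂ (inj₂ (≤-reflexive (trans (sym r+o≡n) (+-comm r o))))
    ; y-far-a = λ where
        (inj₁ (o≤t+r , _)) → absurd-≤ o≤t+r (≤-from (+-mono-≤ short n≤r+o) 0 (solve (o ∷ r ∷ t ∷ n ∷ [])))
        (inj₂ (inj₁ wrap)) → absurd-≤ wrap (≤-from short (o + r) (solve (o ∷ r ∷ t ∷ n ∷ [])))
        (inj₂ (inj₂ wrap)) → absurd-≤ wrap (≤-from (+-mono-≤ 1≤t (≤-reflexive r+o≡n)) 0 (solve (o ∷ r ∷ t ∷ n ∷ [])))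
    ; y-near-b = inj₁ ( ≤-from 1≤t 0 (solve (r ∷ t ∷ []))
                      , ≤-from (+-mono-≤ short n≤4r+1) 1 (solve (r ∷ t ∷ n ∷ [])))
    ; x-far-b = λ where
        (inj₁ (r+1≤r , _)) → absurd-≤ r+1≤r (≤-slack 0 (solve (r ∷ [])))
        (inj₂ (inj₁ wrap)) → absurd-≤ wrap (≤-slack n (solve (r ∷ n ∷ [])))
        (inj₂ (inj₂ wrap)) → absurd-≤ wrap (≤-from 3r+2≤n r (solve (r ∷ n ∷ [])))
    }
    where
    n≤r+o : n ≤ r + o
    n≤r+o = ≤-reflexive (sym r+o≡n)
    regroup : o + (2 * r + 1) ≡ r + 1 + (r + o)
    regroup = solve (o ∷ r ∷ [])

-- Long separation n < t + 2r + 1 ≤ 4r + 1: take i = x ⊕ (t + r + 1), one step past the r-ball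
-- of x ⊕ t; then i ⊕ (2r+1) = x ⊕ s with s + n = t + 3r + 2.
offsets-long : ∀ {n r t} → 3 * r + 2 ≤ n → n ≤ 4 * r + 1 → t ≤ 2 * r → n < t + (2 * r + 1) →
  SeparatingOffsets n r t
offsets-long {n} {r} {t} 3r+2≤n n≤4r+1 t≤2r long = build (m≤n⇒∃[o]m+o≡n n≤t+3r+2)
  where
  n≤t+3r+2 : n ≤ t + (3 * r + 2)
  n≤t+3r+2 = ≤-from long (r + 2) (solve (r ∷ t ∷ n ∷ []))
  build : ∃[ s ] n + s ≡ t + (3 * r + 2) → SeparatingOffsets n r t
  build (s , n+s≡t+3r+2) = record
    { a = t + (r + 1)
    ; b = s
    ; a<n = ≤-from (+-mono-≤ t≤2r 3r+2≤n) 0 (solve (r ∷ t ∷ n ∷ []))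
    ; b<n = ≤-from s+r<n r (solve (r ∷ s ∷ n ∷ []))
    ; paired = trans regroup (trans (sym n+s≡t+3r+2) (+-comm n s))
    ; x-near-a = inj₂ (inj₂ (≤-from long 1 (solve (r ∷ t ∷ n ∷ []))))
    ; y-far-a = λ where
        (inj₁ (a≤t+r , _)) → absurd-≤ a≤t+r (≤-slack 0 (solve (r ∷ t ∷ [])))
        (inj₂ (inj₁ wrap)) → absurd-≤ wrap (≤-slack n (solve (r ∷ t ∷ n ∷ [])))
        (inj₂ (inj₂ wrap)) → absurd-≤ wrap (≤-from 3r+2≤n r (solve (r ∷ t ∷ n ∷ [])))
    ; y-near-b = inj₁ ( ≤-from (+-mono-≤ s≤ 3r+2≤n) r (solve (r ∷ s ∷ t ∷ n ∷ []))
                      , ≤-from (+-mono-≤ s≥ n≤4r+1) 1 (solve (r ∷ s ∷ t ∷ n ∷ [])))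
    ; x-far-b = λ where
        (inj₁ (s≤r , _)) → absurd-≤ s≤r (≤-from (+-mono-≤ s≥ long) 1 (solve (r ∷ s ∷ t ∷ n ∷ [])))
        (inj₂ (inj₁ wrap)) → absurd-≤ wrap (≤-from 3r+2≤n (s + 2 * r + 1) (solve (r ∷ s ∷ n ∷ [])))
        (inj₂ (inj₂ wrap)) → absurd-≤ wrap s+r<n
    }
    where
    s≤ : n + s ≤ t + (3 * r + 2)
    s≤ = ≤-reflexive n+s≡t+3r+2
    s≥ : t + (3 * r + 2) ≤ n + s
    s≥ = ≤-reflexive (sym n+s≡t+3r+2)
    -- s ≤ 2r, while n ≥ 3r + 2
    s+r<n : s + r < n
    s+r<n = ≤-from (+-mono-≤ (+-mono-≤ (+-mono-≤ s≤ t≤2r) 3r+2≤n) 3r+2≤n) 1 (solve (r ∷ s ∷ t ∷ n ∷ []))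
    regroup : t + (r + 1) + (2 * r + 1) ≡ t + (3 * r + 2)
    regroup = solve (r ∷ t ∷ [])

PairsMeet : (n : ℕ) .{{_ : NonZero n}} → ℕ → Subset n → Set
PairsMeet n r D = ∀ i → i ∈ D ⊎ shift n i (2 * r + 1) ∈ D

separated-by-pair : ∀ {n} {G : Graph n} {r D x y i j} →
  DistLe G r x i → ¬ DistLe G r y i → DistLe G r y j → ¬ DistLe G r x j → i ∈ D ⊎ j ∈ D →
  ¬ (∀ z → InDr G r D x z ⇔ InDr G r D y z)
separated-by-pair x~i y≁i _ _ (inj₁ i∈D) same = y≁i (proj₂ (Equivalence.to (same _) (i∈D , x~i)))
separated-by-pair _ _ y~j x≁j (inj₂ j∈D) same = x≁j (proj₂ (Equivalence.from (same _) (j∈D , y~j)))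

module CycleCodes (n r : ℕ) .{{_ : NonZero n}} (D : Subset n) where
  open Rotation n
  open CycleDistance n

  Same : Fin n → Fin n → Set
  Same x y = ∀ z → InDr (Cycle n) r D x z ⇔ InDr (Cycle n) r D y z

  Same-sym : ∀ {x y} → Same x y → Same y x
  Same-sym same z = ⇔-sym (same z)

  dist-from⇔close : ∀ {x b} → r < n → b < n → DistLe (Cycle n) r x (x ⊕ b) ⇔ Close n r 0 b
  dist-from⇔close {x} {b} r<n b<n =
    subst (λ v → DistLe (Cycle n) r v (x ⊕ b) ⇔ Close n r 0 b) (⊕-zero x) (dist⇔close (>-nonZero⁻¹ n) b<n r<n)

  -- (⇒) If x_i and x_{i+2r+1} are both missing from D, then D_r(x_{i+r}) = D_r(x_{i+r+1}).
  code⇒pairsMeet : 2 * r + 1 < n → IsIdentifyingCode (Cycle n) r D → PairsMeet n r D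
  code⇒pairsMeet 2r+1<n (_ , separating) i with i ∈? D | i ⊕ (2 * r + 1) ∈? D
  ... | yes i∈D | _ = inj₁ i∈D
  ... | no _ | yes j∈D = inj₂ j∈D
  ... | no i∉D | no j∉D = ⊥-elim (separating (i ⊕ (r + 1)) (i ⊕ r) distinct same)
    where
    r<n : r < n
    r<n = ≤-from 2r+1<n (r + 1) (solve (r ∷ n ∷ []))
    r+1<n : r + 1 < n
    r+1<n = ≤-from 2r+1<n r (solve (r ∷ n ∷ []))
    distinct : i ⊕ (r + 1) ≢ i ⊕ r
    distinct eq = m+1+n≢m r (⊕-injective i r+1<n r<n eq)
    same : Same (i ⊕ (r + 1)) (i ⊕ r)
    same z with offset i z
    ... | u , u<n , refl = mk⇔ (λ (z∈D , d) → z∈D , back z∈D d) (λ (z∈D , d) → z∈D , forth z∈D d)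
      where
      back : i ⊕ u ∈ D → DistLe (Cycle n) r (i ⊕ (r + 1)) (i ⊕ u) → DistLe (Cycle n) r (i ⊕ r) (i ⊕ u)
      back z∈D d = Equivalence.from (dist⇔close r<n u<n r<n)
        (close-shift-back 2r+1<n u<n (λ u≡2r+1 → j∉D (subst (λ v → i ⊕ v ∈ D) u≡2r+1 z∈D))
          (Equivalence.to (dist⇔close r+1<n u<n r<n) d))
      forth : i ⊕ u ∈ D → DistLe (Cycle n) r (i ⊕ r) (i ⊕ u) → DistLe (Cycle n) r (i ⊕ (r + 1)) (i ⊕ u)
      forth z∈D d = Equivalence.from (dist⇔close r+1<n u<n r<n)
        (close-shift-forward 2r+1<n u<n (λ u≡0 → i∉D (subst (_∈ D) (trans (cong (i ⊕_) u≡0) (⊕-zero i)) z∈D))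
          (Equivalence.to (dist⇔close r<n u<n r<n) d))

  -- (⇐, domination) The pair {x_{j+r}, x_{j+3r+1}} lies in the r-ball of x_j when n ≤ 4r + 1.
  pairsMeet⇒dominating : 3 * r + 2 ≤ n → n ≤ 4 * r + 1 → PairsMeet n r D → ∀ x → ∃[ z ] InDr (Cycle n) r D x z
  pairsMeet⇒dominating 3r+2≤n n≤4r+1 pairs x = dominate (pairs (x ⊕ r))
    where
    r<n : r < n
    r<n = ≤-from 3r+2≤n (2 * r + 1) (solve (r ∷ n ∷ []))
    3r+1<n : r + (2 * r + 1) < n
    3r+1<n = ≤-from 3r+2≤n 0 (solve (r ∷ n ∷ []))
    dominate : x ⊕ r ∈ D ⊎ x ⊕ r ⊕ (2 * r + 1) ∈ D → ∃[ z ] InDr (Cycle n) r D x z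
    dominate (inj₁ c∈D) = x ⊕ r , c∈D , Equivalence.from (dist-from⇔close r<n r<n) (inj₁ (≤-refl , z≤n))
    dominate (inj₂ c∈D) = x ⊕ r ⊕ (2 * r + 1) , c∈D ,
      subst (DistLe (Cycle n) r x) (sym (⊕-assoc x r (2 * r + 1)))
        (Equivalence.from (dist-from⇔close r<n 3r+1<n) (close-3r+1 n≤4r+1))

  offsets-separate : r < n → PairsMeet n r D → ∀ x {t} → t < n → SeparatingOffsets n r t → ¬ Same x (x ⊕ t)
  offsets-separate r<n pairs x {t} t<n offsets = separated-by-pair
    (Equivalence.from (dist-from⇔close r<n a<n) x-near-a)
    (λ d → y-far-a (Equivalence.to (dist⇔close t<n a<n r<n) d))
    (subst (DistLe (Cycle n) r (x ⊕ t)) partner (Equivalence.from (dist⇔close t<n b<n r<n) y-near-b))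
    (λ d → x-far-b (Equivalence.to (dist-from⇔close r<n b<n) (subst (DistLe (Cycle n) r x) (sym partner) d)))
    (pairs (x ⊕ a))
    where
    open SeparatingOffsets offsets
    partner : x ⊕ b ≡ x ⊕ a ⊕ (2 * r + 1)
    partner = begin
      x ⊕ b                  ≡⟨ ⊕-period x b ⟨
      x ⊕ (b + n)            ≡⟨ cong (x ⊕_) paired ⟨
      x ⊕ (a + (2 * r + 1))  ≡⟨ ⊕-assoc x a (2 * r + 1) ⟨
      x ⊕ a ⊕ (2 * r + 1)    ∎
      where open ≡-Reasoning

  -- (⇐, separation) Write y = x ⊕ t; a short, a reversed short (swap x and y), or a long offset.
  pairsMeet⇒separating : 1 ≤ r → 3 * r + 2 ≤ n → n ≤ 4 * r + 1 → PairsMeet n r D → ∀ x y → x ≢ y → ¬ Same x y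
  pairsMeet⇒separating 1≤r 3r+2≤n n≤4r+1 pairs x y x≢y with offset x y
  ... | t , t<n , refl = cases (t + (2 * r + 1) ≤? n) (2 * r + 1 ≤? t)
    where
    separate : ∀ x {t} → t < n → SeparatingOffsets n r t → ¬ Same x (x ⊕ t)
    separate = offsets-separate (≤-from 3r+2≤n (2 * r + 1) (solve (r ∷ n ∷ []))) pairs
    cases : Dec (t + (2 * r + 1) ≤ n) → Dec (2 * r + 1 ≤ t) → ¬ Same x (x ⊕ t)
    cases (yes short) _ = separate x t<n (offsets-short 1≤r 3r+2≤n n≤4r+1 1≤t short)
      where
      1≤t : 1 ≤ t
      1≤t = n≢0⇒n>0 (λ t≡0 → x≢y (trans (sym (⊕-zero x)) (cong (x ⊕_) (sym t≡0))))
    cases (no _) (yes 2r+1≤t) same = separate (x ⊕ t) (∸-monoʳ-< 0<t (<⇒≤ t<n))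
        (offsets-short 1≤r 3r+2≤n n≤4r+1 (m<n⇒0<n∸m t<n) reversed)
        (subst (Same (x ⊕ t)) (sym (⊕-full-turn x (<⇒≤ t<n))) (Same-sym same))
      where
      0<t : 0 < t
      0<t = ≤-trans (m≤n+m 1 (2 * r)) 2r+1≤t
      reversed : n ∸ t + (2 * r + 1) ≤ n
      reversed = ≤-trans (+-monoʳ-≤ (n ∸ t) 2r+1≤t) (≤-reflexive (m∸n+n≡m (<⇒≤ t<n)))
    cases (no ¬short) (no ¬far) = separate x t<n (offsets-long 3r+2≤n n≤4r+1 t≤2r (≰⇒> ¬short))
      where
      t≤2r : t ≤ 2 * r
      t≤2r = ≤-from (≰⇒> ¬far) 0 (solve (r ∷ t ∷ []))

lemma4 : (r n : ℕ) → 1 ≤ r → 3 * r + 2 ≤ n → n ≤ 4 * r + 1 → .{{_ : NonZero n}} → (D : Subset n) →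
    IsIdentifyingCode (Cycle n) r D ⇔ (∀ (i : Fin n) → i ∈ D ⊎ shift n i (2 * r + 1) ∈ D)
lemma4 r n 1≤r 3r+2≤n n≤4r+1 D = mk⇔ (code⇒pairsMeet 2r+1<n)
  (λ pairs → pairsMeet⇒dominating 3r+2≤n n≤4r+1 pairs , pairsMeet⇒separating 1≤r 3r+2≤n n≤4r+1 pairs)
  where
  open CycleCodes n r D
  2r+1<n : 2 * r + 1 < n
  2r+1<n = ≤-from 3r+2≤n r (solve (r ∷ n ∷ []))
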